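{- Let $G_1$ and $G_2$ be vertex-disjoint finite simple undirected graphs, $v\in V_{G_1}$ and $w\in V_{G_2}$. Then \[\operatorname{nlcw}(G_1\oplus_{v,w}G_2)\le\max(\operatorname{nlcw}(G_1),\operatorname{nlcw}(G_2))+2\quad\text{and}\quad \operatorname{cw}(G_1\oplus_{v,w}G_2)\le\max(\operatorname{cw}(G_1),\operatorname{cw}(G_2))+2.\]
   Context: 1-sum: $G_1\oplus_{v,w}G_2$ is obtained from the disjoint union of $G_1$ and $G_2$ by identifying $v$ and $w$: its vertex set is $(V_{G_1}\cup V_{G_2})\setminus\{v,w\}\cup\{z\}$ for a new vertex $z$, its edges are all edges of $G_1$ and $G_2$ not incident to $v$ or $w$, together with $\{z,z_1\}$ for every $z_1\in N_{G_1}(v)\cup N_{G_2}(w)$. Clique-width: for a positive integer $k$, $\mathrm{CW}_k$ is the smallest class of graphs whose vertices carry labels from $\{1,\dots,k\}$ that contains every single-vertex graph with any label and is closed under: disjoint union; relabeling $\rho_{a\to b}$ for $a\neq b$; and $\eta_{a,b}$ for $a\neq b$ (add all edges between vertices labeled $a$ and vertices labeled $b$). $\operatorname{cw}(G)$ is the least $k$ such that some labeling of $G$ lies in $\mathrm{CW}_k$. NLC-width: $\mathrm{NLC}_k$ is the smallest class of labeled graphs (labels in $\{1,\dots,k\}$) containing every single-vertex graph with any label and closed under: $G\times_S J$ for $S\subseteq\{1,\dots,k\}^2$ (disjoint union of vertex-disjoint $G$ and $J$ plus all edges $\{u,v\}$, $u\in V_G$, $v\in V_J$, $(\mathrm{lab}(u),\mathrm{lab}(v))\in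 S$); and $\circ_R$ for $R:\{1,\dots,k\}\to\{1,\dots,k\}$. $\operatorname{nlcw}(G)$ is the least $k$ such that some labeling of $G$ lies in $\mathrm{NLC}_k$. -}

module Defs where

open import Data.Nat using (ℕ; zero; suc; _+_; _≤_)
open import Data.Fin using (Fin; splitAt; punchIn; _≟_)
open import Data.Sum using (_⊎_; inj₁; inj₂)
open import Data.Product using (Σ; _×_; _,_)
open import Data.Bool using (Bool; true; false; _∧_; _∨_; if_then_else_)
open import Relation.Nullary using (¬_; does)
open import Relation.Binary.PropositionalEquality using (_≡_; _≢_; refl)
open import Function.Bundles using (_↔_; Inverse)

_==_ : ∀ {n} → Fin n → Fin n → Bool
x == y = does (x ≟ y)

record Graph (n : ℕ) : Set where
  field
    adj    : Fin n → Fin n → Bool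
    sym    : ∀ x y → adj x y ≡ adj y x
    irrefl : ∀ x → adj x x ≡ false
open Graph public

Iso : ∀ {n m} → (Fin n → Fin n → Bool) → (Fin m → Fin m → Bool) → Set
Iso {n} {m} A B =
  Σ (Fin n ↔ Fin m) λ σ →
    ∀ x y → A x y ≡ B (Inverse.to σ x) (Inverse.to σ y)

-- G₂ has vertex set Fin (suc m); its vertices other than w are
-- punchIn w j for j : Fin m.  The 1-sum has vertex set Fin n ⊎ Fin m
-- (encoded as Fin (n + m)), where the vertex v of G₁ plays the role of
-- the new identified vertex z.

module _ {n m : ℕ} (G₁ : Graph n) (G₂ : Graph (suc m))
         (v : Fin n) (w : Fin (suc m)) where

  adjSum : Fin n ⊎ Fin m → Fin n ⊎ Fin m → Bool
  adjSum (inj₁ x) (inj₁ y) = adj G₁ x y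
  adjSum (inj₂ p) (inj₂ q) = adj G₂ (punchIn w p) (punchIn w q)
  adjSum (inj₁ x) (inj₂ q) = (x == v) ∧ adj G₂ w (punchIn w q)
  adjSum (inj₂ p) (inj₁ y) = (y == v) ∧ adj G₂ w (punchIn w p)

  adjSum-sym : ∀ s t → adjSum s t ≡ adjSum t s
  adjSum-sym (inj₁ x) (inj₁ y) = sym G₁ x y
  adjSum-sym (inj₂ p) (inj₂ q) = sym G₂ (punchIn w p) (punchIn w q)
  adjSum-sym (inj₁ x) (inj₂ q) = refl
  adjSum-sym (inj₂ p) (inj₁ y) = refl

  adjSum-irr : ∀ s → adjSum s s ≡ false
  adjSum-irr (inj₁ x) = irrefl G₁ x
  adjSum-irr (inj₂ p) = irrefl G₂ (punchIn w p)

  oneSum : Graph (n + m)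
  oneSum = record
    { adj    = λ i j → adjSum (splitAt n i) (splitAt n j)
    ; sym    = λ i j → adjSum-sym (splitAt n i) (splitAt n j)
    ; irrefl = λ i → adjSum-irr (splitAt n i)
    }

data CWExpr (k : ℕ) : ℕ → Set where
  cw-vert  : Fin k → CWExpr k 1
  cw-union : ∀ {a b} → CWExpr k a → CWExpr k b → CWExpr k (a + b)
  cw-ρ     : ∀ {n} (a b : Fin k) → a ≢ b → CWExpr k n → CWExpr k n
  cw-η     : ∀ {n} (a b : Fin k) → a ≢ b → CWExpr k n → CWExpr k n

cw-lab : ∀ {k n} → CWExpr k n → Fin n → Fin k
cw-lab (cw-vert c) _ = c
cw-lab (cw-union {a} e f) i with splitAt a i
... | inj₁ x = cw-lab e x
... | inj₂ y = cw-lab f y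
cw-lab (cw-ρ a b _ e) i = if cw-lab e i == a then b else cw-lab e i
cw-lab (cw-η _ _ _ e) i = cw-lab e i

cw-adj : ∀ {k n} → CWExpr k n → Fin n → Fin n → Bool
cw-adj (cw-vert _) _ _ = false
cw-adj (cw-union {a} e f) i j with splitAt a i | splitAt a j
... | inj₁ x | inj₁ y = cw-adj e x y
... | inj₂ x | inj₂ y = cw-adj f x y
... | inj₁ _ | inj₂ _ = false
... | inj₂ _ | inj₁ _ = false
cw-adj (cw-ρ _ _ _ e) i j = cw-adj e i j
cw-adj (cw-η a b _ e) i j =
  cw-adj e i j
  ∨ ((cw-lab e i == a) ∧ (cw-lab e j == b))
  ∨ ((cw-lab e i == b) ∧ (cw-lab e j == a))

HasCW : ∀ {n} → Graph n → ℕ → Set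
HasCW {n} G k = Σ (CWExpr k n) λ e → Iso (cw-adj e) (adj G)

IsCW : ∀ {n} → Graph n → ℕ → Set
IsCW G k = HasCW G k × (∀ j → HasCW G j → k ≤ j)

-- NLC-width expressions.  A set S ⊆ [k]² is given by its characteristic
-- function Fin k → Fin k → Bool.

data NLCExpr (k : ℕ) : ℕ → Set where
  nlc-vert  : Fin k → NLCExpr k 1
  nlc-times : ∀ {a b} → (Fin k → Fin k → Bool) →
              NLCExpr k a → NLCExpr k b → NLCExpr k (a + b)
  nlc-relab : ∀ {n} → (Fin k → Fin k) → NLCExpr k n → NLCExpr k n

nlc-lab : ∀ {k n} → NLCExpr k n → Fin n → Fin k
nlc-lab (nlc-vert c) _ = c
nlc-lab (nlc-times {a} _ e f) i with splitAt a i
... | inj₁ x = nlc-lab e x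
... | inj₂ y = nlc-lab f y
nlc-lab (nlc-relab R e) i = R (nlc-lab e i)

nlc-adj : ∀ {k n} → NLCExpr k n → Fin n → Fin n → Bool
nlc-adj (nlc-vert _) _ _ = false
nlc-adj (nlc-times {a} S e f) i j with splitAt a i | splitAt a j
... | inj₁ x | inj₁ y = nlc-adj e x y
... | inj₂ x | inj₂ y = nlc-adj f x y
... | inj₁ x | inj₂ y = S (nlc-lab e x) (nlc-lab f y)
... | inj₂ x | inj₁ y = S (nlc-lab e y) (nlc-lab f x)
nlc-adj (nlc-relab _ e) i j = nlc-adj e i j

HasNLCW : ∀ {n} → Graph n → ℕ → Set
HasNLCW {n} G k = Σ (NLCExpr k n) λ e → Iso (nlc-adj e) (adj G)

IsNLCW : ∀ {n} → Graph n → ℕ → Set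
IsNLCW G k = HasNLCW G k × (∀ j → HasNLCW G j → k ≤ j)

-- Bring the expressions for G₁ and G₂ to a common label set of size k = max(k₁, k₂) and add
-- two labels, a port label and an inert one.  In the expression for G₁ give v the port label
-- and let every operation involving v's current label act on the port label as well; finally
-- make all other labels inert.  The result still generates G₁, and v is the only vertex that
-- later operations can see.  Substituting it for the leaf creating w in the expression for G₂,
-- the port label now imitating w, generates the 1-sum, v playing the identified vertex.

module Submission where

open import Defs hiding (sym)
open import Data.Bool using (Bool; true; false; _∧_; _∨_; if_then_else_)
open import Data.Bool.Instances
open import Data.Bool.Properties using (∨-assoc; ∨-identityʳ; ∧-zeroʳ; ∧-distribˡ-∨; if-float)
open import Data.Bool.Solver using (module ∨-∧-Solver)
open import Data.Empty using (⊥-elim-irr)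
open import Data.Fin using (Fin; toℕ; fromℕ<; inject≤; splitAt; punchIn; punchOut)
open import Data.Fin.Instances
open import Data.Fin.Permutation using (↔⇒≡)
open import Data.Fin.Properties
  using (1↔⊤; 2↔Bool; +↔⊎; toℕ-injective; toℕ-fromℕ<; toℕ-inject≤; toℕ<n;
         punchInᵢ≢i; punchIn-punchOut; punchOut-punchIn; punchOut-cong)
open import Data.List using (List; []; _∷_; allFin)
open import Data.List.Membership.Propositional using (_∈_)
open import Data.List.Membership.Propositional.Properties using (∈-allFin)
open import Data.List.Relation.Unary.Any using (tail)
open import Data.Maybe using (Maybe; just; nothing; is-just; maybe′)
open import Data.Maybe.Properties using (just-injective)
open import Data.Nat using (ℕ; suc; _+_; _≤_; _<_; _<?_; _⊔_)
open import Data.Nat.Properties using (m≤m⊔n; m≤n⊔m)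
open import Data.Product using (_×_; _,_)
open import Data.Sum using (_⊎_; inj₁; inj₂; [_,_]; map₁; map₂; isInj₁)
open import Data.Sum.Function.Propositional using (_⊎-↔_)
open import Data.Sum.Instances
open import Data.Sum.Properties using (≡-dec; inj₁-injective; inj₂-injective)
open import Data.Unit using (⊤; tt)
import Data.Unit.Properties as ⊤
open import Function using (_∘_; const)
open import Function.Bundles using (_↔_; Inverse; mk↔ₛ′)
open import Function.Properties.Inverse using (↔-refl; ↔-sym; ↔-trans)
open import Relation.Binary.Definitions using (DecidableEquality)
open import Relation.Binary.PropositionalEquality
  using (_≡_; _≢_; refl; sym; trans; cong; cong₂; subst; module ≡-Reasoning)
open import Relation.Binary.TypeClasses using (IsDecEquivalence; _≟_)
open import Relation.Nullary using (does; yes; no; contradiction)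
open import Relation.Nullary.Decidable using (dec-true; dec-false)

open Inverse using (to; from; strictlyInverseˡ; strictlyInverseʳ)

Adj : Set → Set
Adj A = A → A → Bool

infix 4 _≅_

record _≅_ {A B : Set} (R : Adj A) (S : Adj B) : Set where
  constructor mk≅
  field
    bijection : A ↔ B
    preserves : ∀ x y → R x y ≡ S (to bijection x) (to bijection y)
open _≅_ public

Iso⇒≅ : ∀ {n m} {R : Adj (Fin n)} {S : Adj (Fin m)} → Iso R S → R ≅ S
Iso⇒≅ (σ , R≡S) = mk≅ σ R≡S

≅⇒Iso : ∀ {n m} {R : Adj (Fin n)} {S : Adj (Fin m)} → R ≅ S → Iso R S
≅⇒Iso (mk≅ σ R≡S) = σ , R≡S

≅-sym : {A B : Set} {R : Adj A} {S : Adj B} → R ≅ S → S ≅ R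
≅-sym {S = S} (mk≅ σ R≡S) = mk≅ (↔-sym σ) λ x y →
  sym (trans (R≡S _ _) (cong₂ S (strictlyInverseˡ σ x) (strictlyInverseˡ σ y)))

≅-trans : {A B C : Set} {R : Adj A} {S : Adj B} {T : Adj C} → R ≅ S → S ≅ T → R ≅ T
≅-trans (mk≅ σ R≡S) (mk≅ τ S≡T) = mk≅ (↔-trans σ τ) λ x y → trans (R≡S x y) (S≡T _ _)

≡⇒≅ : {A : Set} {R S : Adj A} → (∀ x y → R x y ≡ S x y) → R ≅ S
≡⇒≅ R≡S = mk≅ ↔-refl R≡S

≅⇒size≡ : ∀ {n m} {R : Adj (Fin n)} {S : Adj (Fin m)} → R ≅ S → n ≡ m
≅⇒size≡ R≅S = ↔⇒≡ (bijection R≅S)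

record Embedding (A B : Set) : Set where
  field
    embed         : A → B
    unembed       : B → Maybe A
    unembed-embed : ∀ a → unembed (embed a) ≡ just a

  embed-injective : ∀ {a a′} → embed a ≡ embed a′ → a ≡ a′
  embed-injective {a} {a′} eq =
    just-injective (trans (sym (unembed-embed a)) (trans (cong unembed eq) (unembed-embed a′)))

inj₁-embedding : {A B : Set} → Embedding A (A ⊎ B)
inj₁-embedding = record { embed = inj₁ ; unembed = isInj₁ ; unembed-embed = λ _ → refl }

↔⇒embedding : {A B : Set} → A ↔ B → Embedding A B
↔⇒embedding σ = record
  { embed = to σ ; unembed = just ∘ from σ ; unembed-embed = cong just ∘ strictlyInverseʳ σ }

inject≤-embedding : ∀ {k K} → k ≤ K → Embedding (Fin k) (Fin K)
inject≤-embedding {k} k≤K = record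
  { embed = λ i → inject≤ i k≤K ; unembed = restrict ; unembed-embed = restrict-inject≤ }
  where
  restrict : Fin _ → Maybe (Fin k)
  restrict j with toℕ j <? k
  ... | yes j<k = just (fromℕ< j<k)
  ... | no _    = nothing

  restrict-inject≤ : ∀ i → restrict (inject≤ i k≤K) ≡ just i
  restrict-inject≤ i with toℕ (inject≤ i k≤K) <? k
  ... | yes i<k = cong just (toℕ-injective (trans (toℕ-fromℕ< i<k) (toℕ-inject≤ i k≤K)))
  ... | no  i≮k = contradiction (subst (_< k) (sym (toℕ-inject≤ i k≤K)) (toℕ<n i)) i≮k

-- Expressions are recast as terms over the tree of their leaves, so that a vertex is a path
-- (Vertex s) rather than a Fin index and substituting a term for a leaf (plug) is structural.
data Shape : Set where
  leaf : Shape
  node : Shape → Shape → Shape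

Vertex : Shape → Set
Vertex leaf       = ⊤
Vertex (node s t) = Vertex s ⊎ Vertex t

size : Shape → ℕ
size leaf       = 1
size (node s t) = size s + size t

Fin↔Vertex : (s : Shape) → Fin (size s) ↔ Vertex s
Fin↔Vertex leaf       = 1↔⊤
Fin↔Vertex (node s t) = ↔-trans +↔⊎ (Fin↔Vertex s ⊎-↔ Fin↔Vertex t)

_≟ᵛ_ : {s : Shape} → DecidableEquality (Vertex s)
_≟ᵛ_ {leaf}     = ⊤._≟_
_≟ᵛ_ {node s t} = ≡-dec _≟ᵛ_ _≟ᵛ_

infix 5 _∖_

record _∖_ (s : Shape) (u : Vertex s) : Set where
  constructor _,_
  field
    vertex    : Vertex s
    .distinct : vertex ≢ u
open _∖_ public

⊤⊎∖↔Vertex : (s : Shape) (u : Vertex s) → (⊤ ⊎ s ∖ u) ↔ Vertex s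
⊤⊎∖↔Vertex s u = mk↔ₛ′ [ const u , vertex ] restore insert-restore restore-insert
  where
  restore : Vertex s → ⊤ ⊎ s ∖ u
  restore x with x ≟ᵛ u
  ... | yes _   = inj₁ tt
  ... | no  x≢u = inj₂ (x , x≢u)

  insert-restore : ∀ x → [ const u , vertex ] (restore x) ≡ x
  insert-restore x with x ≟ᵛ u
  ... | yes x≡u = sym x≡u
  ... | no  _   = refl

  restore-insert : ∀ c → restore ([ const u , vertex ] c) ≡ c
  restore-insert (inj₁ tt) with u ≟ᵛ u
  ... | yes _   = refl
  ... | no  u≢u = contradiction refl u≢u
  restore-insert (inj₂ (x , x≢u)) with x ≟ᵛ u
  ... | yes x≡u = ⊥-elim-irr (x≢u x≡u)
  ... | no  _   = refl

plug : (s : Shape) → Vertex s → Shape → Shape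
plug leaf       _        t = t
plug (node s r) (inj₁ x) t = node (plug s x t) r
plug (node r s) (inj₂ y) t = node r (plug s y t)

plugIn : ∀ s u {t} → Vertex t ⊎ s ∖ u → Vertex (plug s u t)
plugIn leaf       _        (inj₁ z)              = z
plugIn leaf       _        (inj₂ (_ , tt≢tt))    = ⊥-elim-irr (tt≢tt refl)
plugIn (node s r) (inj₁ x) (inj₁ z)              = inj₁ (plugIn s x (inj₁ z))
plugIn (node s r) (inj₁ x) (inj₂ (inj₁ y , y≢x)) = inj₁ (plugIn s x (inj₂ (y , y≢x ∘ cong inj₁)))
plugIn (node s r) (inj₁ x) (inj₂ (inj₂ y , _))   = inj₂ y
plugIn (node r s) (inj₂ x) (inj₁ z)              = inj₂ (plugIn s x (inj₁ z))
plugIn (node r s) (inj₂ x) (inj₂ (inj₁ y , _))   = inj₁ y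
plugIn (node r s) (inj₂ x) (inj₂ (inj₂ y , y≢x)) = inj₂ (plugIn s x (inj₂ (y , y≢x ∘ cong inj₂)))

∖-inj₁ : ∀ {s r x} → s ∖ x → node s r ∖ inj₁ x
∖-inj₁ (y , y≢x) = inj₁ y , y≢x ∘ inj₁-injective

∖-inj₂ : ∀ {r s x} → s ∖ x → node r s ∖ inj₂ x
∖-inj₂ (y , y≢x) = inj₂ y , y≢x ∘ inj₂-injective

plugOut : ∀ s u {t} → Vertex (plug s u t) → Vertex t ⊎ s ∖ u
plugOut leaf       _        z        = inj₁ z
plugOut (node s r) (inj₁ x) (inj₁ p) = map₂ ∖-inj₁ (plugOut s x p)
plugOut (node s r) (inj₁ x) (inj₂ y) = inj₂ (inj₂ y , λ ())
plugOut (node r s) (inj₂ x) (inj₁ y) = inj₂ (inj₁ y , λ ())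
plugOut (node r s) (inj₂ x) (inj₂ p) = map₂ ∖-inj₂ (plugOut s x p)

plugIn-plugOut : ∀ s u {t} (p : Vertex (plug s u t)) → plugIn s u (plugOut s u p) ≡ p
plugIn-plugOut leaf       _        z        = refl
plugIn-plugOut (node s r) (inj₁ x) (inj₁ p) with plugOut s x p | plugIn-plugOut s x p
... | inj₁ _ | eq = cong inj₁ eq
... | inj₂ _ | eq = cong inj₁ eq
plugIn-plugOut (node s r) (inj₁ x) (inj₂ y) = refl
plugIn-plugOut (node r s) (inj₂ x) (inj₁ y) = refl
plugIn-plugOut (node r s) (inj₂ x) (inj₂ p) with plugOut s x p | plugIn-plugOut s x p
... | inj₁ _ | eq = cong inj₂ eq
... | inj₂ _ | eq = cong inj₂ eq

plugOut-plugIn : ∀ s u {t} (c : Vertex t ⊎ s ∖ u) → plugOut s u (plugIn s u c) ≡ c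
plugOut-plugIn leaf       _        (inj₁ z)            = refl
plugOut-plugIn leaf       _        (inj₂ (_ , tt≢tt))  = ⊥-elim-irr (tt≢tt refl)
plugOut-plugIn (node s r) (inj₁ x) (inj₁ z)            = cong (map₂ ∖-inj₁) (plugOut-plugIn s x (inj₁ z))
plugOut-plugIn (node s r) (inj₁ x) (inj₂ (inj₁ y , _)) =
  cong (map₂ ∖-inj₁) (plugOut-plugIn s x (inj₂ (y , _)))
plugOut-plugIn (node s r) (inj₁ x) (inj₂ (inj₂ y , _)) = refl
plugOut-plugIn (node r s) (inj₂ x) (inj₁ z)            = cong (map₂ ∖-inj₂) (plugOut-plugIn s x (inj₁ z))
plugOut-plugIn (node r s) (inj₂ x) (inj₂ (inj₁ y , _)) = refl
plugOut-plugIn (node r s) (inj₂ x) (inj₂ (inj₂ y , _)) =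
  cong (map₂ ∖-inj₂) (plugOut-plugIn s x (inj₂ (y , _)))

plug↔ : ∀ s u t → (Vertex t ⊎ s ∖ u) ↔ Vertex (plug s u t)
plug↔ s u t = mk↔ₛ′ (plugIn s u) (plugOut s u) (plugIn-plugOut s u) (plugOut-plugIn s u)

∖-≡ : ∀ {s u} {r r′ : s ∖ u} → vertex r ≡ vertex r′ → r ≡ r′
∖-≡ {r = _ , _} {_ , _} refl = refl

module _ {s : Shape} {m : ℕ} (σ : Vertex s ↔ Fin (suc m)) (w : Fin (suc m)) where

  private
    w≢σ : (r : s ∖ from σ w) → w ≢ to σ (vertex r)
    w≢σ (x , x≢ŵ) w≡σx =
      ⊥-elim-irr (x≢ŵ (trans (sym (strictlyInverseʳ σ x)) (cong (from σ) (sym w≡σx))))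

    σ⁻¹punchIn : Fin m → s ∖ from σ w
    σ⁻¹punchIn j = from σ (punchIn w j) , λ eq →
      punchInᵢ≢i w j (trans (sym (strictlyInverseˡ σ _)) (trans (cong (to σ) eq) (strictlyInverseˡ σ w)))

  ∖↔punched : s ∖ from σ w ↔ Fin m
  ∖↔punched = mk↔ₛ′ (λ r → punchOut (w≢σ r)) σ⁻¹punchIn
    (λ j → trans (punchOut-cong w (strictlyInverseˡ σ (punchIn w j))) (punchOut-punchIn w))
    (λ r → ∖-≡ (trans (cong (from σ) (punchIn-punchOut (w≢σ r))) (strictlyInverseʳ σ (vertex r))))

  punchIn-∖↔punched : ∀ r → punchIn w (to ∖↔punched r) ≡ to σ (vertex r)
  punchIn-∖↔punched r = punchIn-punchOut (w≢σ r)

substitute : ∀ {s} {T : Set} → Adj (Vertex s) → (u : Vertex s) → Adj T → (T → Bool) →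
             Adj (T ⊎ s ∖ u)
substitute E u H port (inj₁ z) (inj₁ z′) = H z z′
substitute E u H port (inj₁ z) (inj₂ r)  = port z ∧ E u (vertex r)
substitute E u H port (inj₂ r) (inj₁ z)  = port z ∧ E u (vertex r)
substitute E u H port (inj₂ r) (inj₂ r′) = E (vertex r) (vertex r′)

substitute-map : ∀ {s} {T T′ : Set} (E : Adj (Vertex s)) (u : Vertex s)
                 {H : Adj T} {H′ : Adj T′} {port : T → Bool} {port′ : T′ → Bool} (f : T′ → T) →
                 (∀ z z′ → H (f z) (f z′) ≡ H′ z z′) → (∀ z → port (f z) ≡ port′ z) →
                 ∀ c c′ → substitute E u H port (map₁ f c) (map₁ f c′)
                          ≡ substitute E u H′ port′ c c′
substitute-map E u f H≡ port≡ (inj₁ z) (inj₁ z′) = H≡ z z′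
substitute-map E u f H≡ port≡ (inj₁ z) (inj₂ r)  = cong (_∧ E u (vertex r)) (port≡ z)
substitute-map E u f H≡ port≡ (inj₂ r) (inj₁ z)  = cong (_∧ E u (vertex r)) (port≡ z)
substitute-map E u f H≡ port≡ (inj₂ r) (inj₂ r′) = refl

substitute-point : ∀ {s} (E : Adj (Vertex s)) (u : Vertex s) →
                   E u u ≡ false → (∀ x → E u x ≡ E x u) →
                   ∀ c c′ → substitute E u (λ _ _ → false) (λ _ → true) c c′
                            ≡ E (to (⊤⊎∖↔Vertex s u) c) (to (⊤⊎∖↔Vertex s u) c′)
substitute-point E u Euu≡false E-sym (inj₁ tt) (inj₁ tt) = sym Euu≡false
substitute-point E u Euu≡false E-sym (inj₁ tt) (inj₂ r)  = refl
substitute-point E u Euu≡false E-sym (inj₂ r)  (inj₁ tt) = E-sym (vertex r)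
substitute-point E u Euu≡false E-sym (inj₂ r)  (inj₂ r′) = refl

module OneSum {n₁ m₂ : ℕ} (G₁ : Graph n₁) (G₂ : Graph (suc m₂)) (v : Fin n₁) (w : Fin (suc m₂))
              {s₁ s₂ : Shape} {E₁ : Adj (Vertex s₁)} {E₂ : Adj (Vertex s₂)}
              (E₁≅G₁ : E₁ ≅ adj G₁) (E₂≅G₂ : E₂ ≅ adj G₂) where

  private
    σ₁ = bijection E₁≅G₁
    σ₂ = bijection E₂≅G₂
    E₁≡G₁ = preserves E₁≅G₁
    E₂≡G₂ = preserves E₂≅G₂

  v̂ : Vertex s₁
  v̂ = from σ₁ v

  ŵ : Vertex s₂
  ŵ = from σ₂ w

  marked : Adj (⊤ ⊎ s₁ ∖ v̂)
  marked = substitute E₁ v̂ (λ _ _ → false) (λ _ → true)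

  -- G₂ with w replaced by G₁, whose only port is v: this is the 1-sum.
  glued : Adj ((⊤ ⊎ s₁ ∖ v̂) ⊎ s₂ ∖ ŵ)
  glued = substitute E₂ ŵ marked (is-just ∘ isInj₁)

  glued≅adjSum : glued ≅ adjSum G₁ G₂ v w
  glued≅adjSum = mk≅ φ glued≡adjSum
    where
    τ₁ : (⊤ ⊎ s₁ ∖ v̂) ↔ Fin n₁
    τ₁ = ↔-trans (⊤⊎∖↔Vertex s₁ v̂) σ₁

    φ : ((⊤ ⊎ s₁ ∖ v̂) ⊎ s₂ ∖ ŵ) ↔ (Fin n₁ ⊎ Fin m₂)
    φ = τ₁ ⊎-↔ ∖↔punched σ₂ w

    marked≡G₁ : ∀ c c′ → marked c c′ ≡ adj G₁ (to τ₁ c) (to τ₁ c′)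
    marked≡G₁ c c′ = trans (substitute-point E₁ v̂ E₁-irrefl E₁-sym c c′) (E₁≡G₁ _ _)
      where
      E₁-irrefl : E₁ v̂ v̂ ≡ false
      E₁-irrefl = trans (E₁≡G₁ v̂ v̂) (irrefl G₁ _)
      E₁-sym : ∀ x → E₁ v̂ x ≡ E₁ x v̂
      E₁-sym x = trans (E₁≡G₁ v̂ x) (trans (Graph.sym G₁ _ _) (sym (E₁≡G₁ x v̂)))

    is-v : ∀ c → (to τ₁ c == v) ≡ is-just (isInj₁ c)
    is-v (inj₁ tt)         = dec-true (to σ₁ v̂ ≟ v) (strictlyInverseˡ σ₁ v)
    is-v (inj₂ (x , x≢v̂)) = dec-false (to σ₁ x ≟ v) λ σx≡v →
      ⊥-elim-irr (x≢v̂ (trans (sym (strictlyInverseʳ σ₁ x)) (cong (from σ₁) σx≡v)))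

    ŵ-E₂≡G₂ : ∀ r → E₂ ŵ (vertex r) ≡ adj G₂ w (punchIn w (to (∖↔punched σ₂ w) r))
    ŵ-E₂≡G₂ r = trans (E₂≡G₂ _ _)
      (cong₂ (adj G₂) (strictlyInverseˡ σ₂ w) (sym (punchIn-∖↔punched σ₂ w r)))

    glued≡adjSum : ∀ c c′ → glued c c′ ≡ adjSum G₁ G₂ v w (to φ c) (to φ c′)
    glued≡adjSum (inj₁ c) (inj₁ c′) = marked≡G₁ c c′
    glued≡adjSum (inj₁ c) (inj₂ r)  = cong₂ _∧_ (sym (is-v c)) (ŵ-E₂≡G₂ r)
    glued≡adjSum (inj₂ r) (inj₁ c)  = cong₂ _∧_ (sym (is-v c)) (ŵ-E₂≡G₂ r)
    glued≡adjSum (inj₂ r) (inj₂ r′) = trans (E₂≡G₂ _ _)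
      (sym (cong₂ (adj G₂) (punchIn-∖↔punched σ₂ w r) (punchIn-∖↔punched σ₂ w r′)))

  adjSum≅oneSum : adjSum G₁ G₂ v w ≅ adj (oneSum G₁ G₂ v w)
  adjSum≅oneSum = mk≅ (↔-sym +↔⊎) λ x y →
    sym (cong₂ (adjSum G₁ G₂ v w) (strictlyInverseˡ +↔⊎ x) (strictlyInverseˡ +↔⊎ y))

  glued≅oneSum : glued ≅ adj (oneSum G₁ G₂ v w)
  glued≅oneSum = ≅-trans glued≅adjSum adjSum≅oneSum

  markedShape : Shape
  markedShape = plug s₁ v̂ leaf

  isPort : Vertex markedShape → Bool
  isPort z = is-just (isInj₁ (plugOut s₁ v̂ z))

  realises-oneSum : {H : Adj (Vertex markedShape)} {P : Adj (Vertex (plug s₂ ŵ markedShape))} →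
                    (∀ c c′ → H (plugIn s₁ v̂ c) (plugIn s₁ v̂ c′) ≡ marked c c′) →
                    (∀ c c′ → P (plugIn s₂ ŵ c) (plugIn s₂ ŵ c′)
                              ≡ substitute E₂ ŵ H isPort c c′) →
                    P ≅ adj (oneSum G₁ G₂ v w)
  realises-oneSum {H} {P} H≡marked P≡substitute =
    ≅-trans (≅-sym (mk≅ ψ glued≡P)) glued≅oneSum
    where
    ψ : ((⊤ ⊎ s₁ ∖ v̂) ⊎ s₂ ∖ ŵ) ↔ Vertex (plug s₂ ŵ markedShape)
    ψ = ↔-trans (plug↔ s₁ v̂ leaf ⊎-↔ ↔-refl) (plug↔ s₂ ŵ markedShape)

    glued≡P : ∀ c c′ → glued c c′ ≡ P (to ψ c) (to ψ c′)
    glued≡P c c′ = sym (trans (P≡substitute _ _) (substitute-map E₂ ŵ (plugIn s₁ v̂) H≡marked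
      (cong (is-just ∘ isInj₁) ∘ plugOut-plugIn s₁ v̂) c c′))

module NLC where

  data Term (L : Set) : Shape → Set where
    single  : L → Term L leaf
    times   : ∀ {s t} → Adj L → Term L s → Term L t → Term L (node s t)
    relabel : ∀ {s} → (L → L) → Term L s → Term L s

  label : ∀ {L s} → Term L s → Vertex s → L
  label (single a)    _        = a
  label (times _ e f) (inj₁ x) = label e x
  label (times _ e f) (inj₂ y) = label f y
  label (relabel R e) x        = R (label e x)

  adjacency : ∀ {L s} → Term L s → Adj (Vertex s)
  adjacency (single _)    _        _        = false
  adjacency (times S e f) (inj₁ x) (inj₁ y) = adjacency e x y
  adjacency (times S e f) (inj₂ x) (inj₂ y) = adjacency f x y
  adjacency (times S e f) (inj₁ x) (inj₂ y) = S (label e x) (label f y)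
  adjacency (times S e f) (inj₂ x) (inj₁ y) = S (label e y) (label f x)
  adjacency (relabel _ e) x        y        = adjacency e x y

  shape : ∀ {k n} → NLCExpr k n → Shape
  shape (nlc-vert _)      = leaf
  shape (nlc-times _ e f) = node (shape e) (shape f)
  shape (nlc-relab _ e)   = shape e

  term : ∀ {k n} (e : NLCExpr k n) → Term (Fin k) (shape e)
  term (nlc-vert a)      = single a
  term (nlc-times S e f) = times S (term e) (term f)
  term (nlc-relab R e)   = relabel R (term e)

  vertices : ∀ {k n} (e : NLCExpr k n) → Fin n ↔ Vertex (shape e)
  vertices (nlc-vert _)      = 1↔⊤
  vertices (nlc-times _ e f) = ↔-trans +↔⊎ (vertices e ⊎-↔ vertices f)
  vertices (nlc-relab _ e)   = vertices e

  label-term : ∀ {k n} (e : NLCExpr k n) i → nlc-lab e i ≡ label (term e) (to (vertices e) i)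
  label-term (nlc-vert _) i = refl
  label-term (nlc-times {a} _ e f) i with splitAt a i
  ... | inj₁ x = label-term e x
  ... | inj₂ y = label-term f y
  label-term (nlc-relab R e) i = cong R (label-term e i)

  adjacency-term : ∀ {k n} (e : NLCExpr k n) i j →
                   nlc-adj e i j ≡ adjacency (term e) (to (vertices e) i) (to (vertices e) j)
  adjacency-term (nlc-vert _) i j = refl
  adjacency-term (nlc-times {a} S e f) i j with splitAt a i | splitAt a j
  ... | inj₁ x | inj₁ y = adjacency-term e x y
  ... | inj₂ x | inj₂ y = adjacency-term f x y
  ... | inj₁ x | inj₂ y = cong₂ S (label-term e x) (label-term f y)
  ... | inj₂ x | inj₁ y = cong₂ S (label-term e y) (label-term f x)
  adjacency-term (nlc-relab _ e) i j = adjacency-term e i j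

  expr : ∀ {k s} → Term (Fin k) s → NLCExpr k (size s)
  expr (single a)    = nlc-vert a
  expr (times S e f) = nlc-times S (expr e) (expr f)
  expr (relabel R e) = nlc-relab R (expr e)

  label-expr : ∀ {k s} (e : Term (Fin k) s) i → nlc-lab (expr e) i ≡ label e (to (Fin↔Vertex s) i)
  label-expr (single a) i = refl
  label-expr (times {s} _ e f) i with splitAt (size s) i
  ... | inj₁ x = label-expr e x
  ... | inj₂ y = label-expr f y
  label-expr (relabel R e) i = cong R (label-expr e i)

  adjacency-expr : ∀ {k s} (e : Term (Fin k) s) i j →
                   nlc-adj (expr e) i j ≡ adjacency e (to (Fin↔Vertex s) i) (to (Fin↔Vertex s) j)
  adjacency-expr (single a) i j = refl
  adjacency-expr (times {s} S e f) i j with splitAt (size s) i | splitAt (size s) j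
  ... | inj₁ x | inj₁ y = adjacency-expr e x y
  ... | inj₂ x | inj₂ y = adjacency-expr f x y
  ... | inj₁ x | inj₂ y = cong₂ S (label-expr e x) (label-expr f y)
  ... | inj₂ x | inj₁ y = cong₂ S (label-expr e y) (label-expr f x)
  adjacency-expr (relabel _ e) i j = adjacency-expr e i j

  term-≅ : ∀ {k n} (e : NLCExpr k n) → nlc-adj e ≅ adjacency (term e)
  term-≅ e = mk≅ (vertices e) (adjacency-term e)

  expr-≅ : ∀ {k s} (e : Term (Fin k) s) → nlc-adj (expr e) ≅ adjacency e
  expr-≅ {s = s} e = mk≅ (Fin↔Vertex s) (adjacency-expr e)

  realised : ∀ {k N M} {G : Graph M} (e : NLCExpr k N) → nlc-adj e ≅ adj G → HasNLCW G k
  realised e e≅G with ≅⇒size≡ e≅G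
  ... | refl = e , ≅⇒Iso e≅G

  module _ {A B : Set} (ι : Embedding A B) where
    open Embedding ι

    liftRel : Adj A → Adj B
    liftRel S x y = maybe′ (λ a → maybe′ (S a) false (unembed y)) false (unembed x)

    liftFun : (A → A) → B → B
    liftFun R x = maybe′ (embed ∘ R) x (unembed x)

    map : ∀ {s} → Term A s → Term B s
    map (single a)    = single (embed a)
    map (times S e f) = times (liftRel S) (map e) (map f)
    map (relabel R e) = relabel (liftFun R) (map e)

    label-map : ∀ {s} (e : Term A s) x → label (map e) x ≡ embed (label e x)
    label-map (single a)    x        = refl
    label-map (times S e f) (inj₁ x) = label-map e x
    label-map (times S e f) (inj₂ y) = label-map f y
    label-map (relabel R e) x rewrite label-map e x | unembed-embed (label e x) = refl

    adjacency-map : ∀ {s} (e : Term A s) x y → adjacency (map e) x y ≡ adjacency e x y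
    adjacency-map (single a) x y = refl
    adjacency-map (times S e f) (inj₁ x) (inj₁ y) = adjacency-map e x y
    adjacency-map (times S e f) (inj₂ x) (inj₂ y) = adjacency-map f x y
    adjacency-map (times S e f) (inj₁ x) (inj₂ y)
      rewrite label-map e x | label-map f y | unembed-embed (label e x) | unembed-embed (label f y) = refl
    adjacency-map (times S e f) (inj₂ x) (inj₁ y)
      rewrite label-map e y | label-map f x | unembed-embed (label e y) | unembed-embed (label f x) = refl
    adjacency-map (relabel R e) x y = adjacency-map e x y

  embeddedTerm-≅ : ∀ {k K n m} {G : Graph m} (k≤K : k ≤ K) (e : NLCExpr k n) → nlc-adj e ≅ adj G →
                   adjacency (map (inject≤-embedding k≤K) (term e)) ≅ adj G
  embeddedTerm-≅ k≤K e e≅G =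
    ≅-trans (≡⇒≅ (adjacency-map _ (term e))) (≅-trans (≅-sym (term-≅ e)) e≅G)

  lift : ∀ {A : Set} {s} → Term A s → Term (A ⊎ Bool) s
  lift = map inj₁-embedding

  label-lift : ∀ {A : Set} {s} (e : Term A s) x → label (lift e) x ≡ inj₁ (label e x)
  label-lift = label-map inj₁-embedding

  adjacency-lift : ∀ {A : Set} {s} (e : Term A s) x y → adjacency (lift e) x y ≡ adjacency e x y
  adjacency-lift = adjacency-map inj₁-embedding

  -- Labels inj₂ true (ports) stand in for a vertex labelled c; labels inj₂ false are inert.
  attach : {A : Set} → A → Adj A → Adj (A ⊎ Bool)
  attach c S (inj₁ a) (inj₁ b) = S a b
  attach c S (inj₁ a) (inj₂ β) = β ∧ S a c
  attach c S (inj₂ β) (inj₁ b) = β ∧ S c b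
  attach c S (inj₂ _) (inj₂ _) = false

  _[_≔_] : ∀ {A : Set} {s t} → Term A s → (u : Vertex s) → Term (A ⊎ Bool) t →
           Term (A ⊎ Bool) (plug s u t)
  single _    [ _      ≔ h ] = h
  times S e f [ inj₁ x ≔ h ] = times (attach (label e x) S) (e [ x ≔ h ]) (lift f)
  times S e f [ inj₂ y ≔ h ] = times (attach (label f y) S) (lift e) (f [ y ≔ h ])
  relabel R e [ u      ≔ h ] = relabel (map₁ R) (e [ u ≔ h ])

  module _ {A : Set} {t : Shape} (h : Term (A ⊎ Bool) t) (port : Vertex t → Bool)
           (h-ports : ∀ z → label h z ≡ inj₂ (port z)) where

    label-≔-port : ∀ {s} (e : Term A s) u z → label (e [ u ≔ h ]) (plugIn s u (inj₁ z)) ≡ inj₂ (port z)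
    label-≔-port (single _)    _        z = h-ports z
    label-≔-port (times _ e f) (inj₁ x) z = label-≔-port e x z
    label-≔-port (times _ e f) (inj₂ y) z = label-≔-port f y z
    label-≔-port (relabel R e) u        z = cong (map₁ R) (label-≔-port e u z)

    label-≔-other : ∀ {s} (e : Term A s) u r →
                    label (e [ u ≔ h ]) (plugIn s u (inj₂ r)) ≡ inj₁ (label e (vertex r))
    label-≔-other (single _)    _        (_ , tt≢tt) = ⊥-elim-irr (tt≢tt refl)
    label-≔-other (times _ e f) (inj₁ x) (inj₁ y , _) = label-≔-other e x (y , _)
    label-≔-other (times _ e f) (inj₁ x) (inj₂ y , _) = label-lift f y
    label-≔-other (times _ e f) (inj₂ x) (inj₁ y , _) = label-lift e y
    label-≔-other (times _ e f) (inj₂ x) (inj₂ y , _) = label-≔-other f x (y , _)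
    label-≔-other (relabel R e) u        r           = cong (map₁ R) (label-≔-other e u r)

    SubstitutionCorrect : ∀ {s} → Term A s → Vertex s → Set
    SubstitutionCorrect {s} e u = ∀ c c′ → adjacency (e [ u ≔ h ]) (plugIn s u c) (plugIn s u c′)
                                           ≡ substitute (adjacency e) u (adjacency h) port c c′

    times-≔ˡ : ∀ {s r} S (e : Term A s) (f : Term A r) x →
               SubstitutionCorrect e x → SubstitutionCorrect (times S e f) (inj₁ x)
    times-≔ˡ S e f x IH (inj₁ z) (inj₁ z′) = IH (inj₁ z) (inj₁ z′)
    times-≔ˡ S e f x IH (inj₁ z) (inj₂ (inj₁ y , _)) = IH (inj₁ z) (inj₂ (y , _))
    times-≔ˡ S e f x IH (inj₁ z) (inj₂ (inj₂ q , _)) =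
      cong₂ (attach (label e x) S) (label-≔-port e x z) (label-lift f q)
    times-≔ˡ S e f x IH (inj₂ (inj₁ y , _)) (inj₁ z) = IH (inj₂ (y , _)) (inj₁ z)
    times-≔ˡ S e f x IH (inj₂ (inj₂ q , _)) (inj₁ z) =
      cong₂ (attach (label e x) S) (label-≔-port e x z) (label-lift f q)
    times-≔ˡ S e f x IH (inj₂ (inj₁ y , _)) (inj₂ (inj₁ y′ , _)) = IH (inj₂ (y , _)) (inj₂ (y′ , _))
    times-≔ˡ S e f x IH (inj₂ (inj₁ y , _)) (inj₂ (inj₂ q , _)) =
      cong₂ (attach (label e x) S) (label-≔-other e x (y , _)) (label-lift f q)
    times-≔ˡ S e f x IH (inj₂ (inj₂ q , _)) (inj₂ (inj₁ y , _)) =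
      cong₂ (attach (label e x) S) (label-≔-other e x (y , _)) (label-lift f q)
    times-≔ˡ S e f x IH (inj₂ (inj₂ q , _)) (inj₂ (inj₂ q′ , _)) = adjacency-lift f q q′

    times-≔ʳ : ∀ {r s} S (e : Term A r) (f : Term A s) y →
               SubstitutionCorrect f y → SubstitutionCorrect (times S e f) (inj₂ y)
    times-≔ʳ S e f y IH (inj₁ z) (inj₁ z′) = IH (inj₁ z) (inj₁ z′)
    times-≔ʳ S e f y IH (inj₁ z) (inj₂ (inj₂ q , _)) = IH (inj₁ z) (inj₂ (q , _))
    times-≔ʳ S e f y IH (inj₁ z) (inj₂ (inj₁ p , _)) =
      cong₂ (attach (label f y) S) (label-lift e p) (label-≔-port f y z)
    times-≔ʳ S e f y IH (inj₂ (inj₂ q , _)) (inj₁ z) = IH (inj₂ (q , _)) (inj₁ z)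
    times-≔ʳ S e f y IH (inj₂ (inj₁ p , _)) (inj₁ z) =
      cong₂ (attach (label f y) S) (label-lift e p) (label-≔-port f y z)
    times-≔ʳ S e f y IH (inj₂ (inj₂ q , _)) (inj₂ (inj₂ q′ , _)) = IH (inj₂ (q , _)) (inj₂ (q′ , _))
    times-≔ʳ S e f y IH (inj₂ (inj₂ q , _)) (inj₂ (inj₁ p , _)) =
      cong₂ (attach (label f y) S) (label-lift e p) (label-≔-other f y (q , _))
    times-≔ʳ S e f y IH (inj₂ (inj₁ p , _)) (inj₂ (inj₂ q , _)) =
      cong₂ (attach (label f y) S) (label-lift e p) (label-≔-other f y (q , _))
    times-≔ʳ S e f y IH (inj₂ (inj₁ p , _)) (inj₂ (inj₁ p′ , _)) = adjacency-lift e p p′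

    adjacency-≔ : ∀ {s} (e : Term A s) u → SubstitutionCorrect e u
    adjacency-≔ (single _)    _        (inj₁ z)           (inj₁ z′)          = refl
    adjacency-≔ (single _)    _        (inj₁ z)           (inj₂ (_ , tt≢tt)) = ⊥-elim-irr (tt≢tt refl)
    adjacency-≔ (single _)    _        (inj₂ (_ , tt≢tt)) _                  = ⊥-elim-irr (tt≢tt refl)
    adjacency-≔ (times S e f) (inj₁ x) = times-≔ˡ S e f x (adjacency-≔ e x)
    adjacency-≔ (times S e f) (inj₂ y) = times-≔ʳ S e f y (adjacency-≔ f y)
    adjacency-≔ (relabel _ e) u        = adjacency-≔ e u

  forget : {A : Set} → A ⊎ Bool → A ⊎ Bool
  forget = [ (λ _ → inj₂ false) , inj₂ ]

  mark : ∀ {A : Set} {s} → Term A s → (u : Vertex s) → Term (A ⊎ Bool) (plug s u leaf)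
  mark e u = relabel forget (e [ u ≔ single (inj₂ true) ])

  module _ {A : Set} {s : Shape} (e : Term A s) (u : Vertex s) where

    label-mark : ∀ z → label (mark e u) z ≡ inj₂ (is-just (isInj₁ (plugOut s u z)))
    label-mark z with plugOut s u z | plugIn-plugOut s u z
    ... | inj₁ tt | refl = cong forget (label-≔-port (single (inj₂ true)) _ (λ _ → refl) e u tt)
    ... | inj₂ r  | refl = cong forget (label-≔-other (single (inj₂ true)) _ (λ _ → refl) e u r)

    adjacency-mark : ∀ c c′ → adjacency (mark e u) (plugIn s u c) (plugIn s u c′)
                              ≡ substitute (adjacency e) u (λ _ _ → false) (λ _ → true) c c′
    adjacency-mark = adjacency-≔ (single (inj₂ true)) (λ _ → true) (λ _ → refl) e u

  oneSum-bound : ∀ {n₁ m₂ k₁ k₂} (G₁ : Graph n₁) (G₂ : Graph (suc m₂))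
                 (v : Fin n₁) (w : Fin (suc m₂)) →
                 HasNLCW G₁ k₁ → HasNLCW G₂ k₂ → HasNLCW (oneSum G₁ G₂ v w) (k₁ ⊔ k₂ + 2)
  oneSum-bound {k₁ = k₁} {k₂} G₁ G₂ v w (e₁ , e₁≅G₁) (e₂ , e₂≅G₂) =
    realised {G = oneSum G₁ G₂ v w} (expr (map encoding glue))
      (≅-trans (expr-≅ (map encoding glue)) (≅-trans (≡⇒≅ (adjacency-map encoding glue)) glue≅oneSum))
    where
    t₁ = map (inject≤-embedding (m≤m⊔n k₁ k₂)) (term e₁)
    t₂ = map (inject≤-embedding (m≤n⊔m k₁ k₂)) (term e₂)
    open OneSum G₁ G₂ v w (embeddedTerm-≅ {G = G₁} (m≤m⊔n k₁ k₂) e₁ (Iso⇒≅ e₁≅G₁))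
                          (embeddedTerm-≅ {G = G₂} (m≤n⊔m k₁ k₂) e₂ (Iso⇒≅ e₂≅G₂))

    glue : Term (Fin (k₁ ⊔ k₂) ⊎ Bool) (plug (shape e₂) ŵ markedShape)
    glue = t₂ [ ŵ ≔ mark t₁ v̂ ]

    glue≅oneSum : adjacency glue ≅ adj (oneSum G₁ G₂ v w)
    glue≅oneSum = realises-oneSum (adjacency-mark t₁ v̂)
                                  (adjacency-≔ (mark t₁ v̂) isPort (label-mark t₁ v̂) t₂ ŵ)

    encoding : Embedding (Fin (k₁ ⊔ k₂) ⊎ Bool) (Fin (k₁ ⊔ k₂ + 2))
    encoding = ↔⇒embedding (↔-trans (↔-refl ⊎-↔ ↔-sym 2↔Bool) (↔-sym (+↔⊎ {k₁ ⊔ k₂})))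

module CW where

  data Term (L : Set) : Shape → Set where
    single : L → Term L leaf
    union  : ∀ {s t} → Term L s → Term L t → Term L (node s t)
    ρ      : ∀ {s} (a b : L) → a ≢ b → Term L s → Term L s
    η      : ∀ {s} (a b : L) → a ≢ b → Term L s → Term L s

  module _ {L : Set} {{_ : IsDecEquivalence {A = L} _≡_}} where

    infix 7 _=ᴸ_
    _=ᴸ_ : L → L → Bool
    x =ᴸ y = does (x ≟ y)

    joins : L → L → Adj L
    joins a b x y = (x =ᴸ a ∧ y =ᴸ b) ∨ (x =ᴸ b ∧ y =ᴸ a)

    label : ∀ {s} → Term L s → Vertex s → L
    label (single a)  _        = a
    label (union e f) (inj₁ x) = label e x
    label (union e f) (inj₂ y) = label f y
    label (ρ a b _ e) x        = if label e x =ᴸ a then b else label e x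
    label (η _ _ _ e) x        = label e x

    adjacency : ∀ {s} → Term L s → Adj (Vertex s)
    adjacency (single _)  _        _        = false
    adjacency (union e f) (inj₁ x) (inj₁ y) = adjacency e x y
    adjacency (union e f) (inj₂ x) (inj₂ y) = adjacency f x y
    adjacency (union e f) (inj₁ _) (inj₂ _) = false
    adjacency (union e f) (inj₂ _) (inj₁ _) = false
    adjacency (ρ _ _ _ e) x        y        = adjacency e x y
    adjacency (η a b _ e) x        y        = adjacency e x y ∨ joins a b (label e x) (label e y)

    ηIf : ∀ {s} → Bool → (a b : L) → a ≢ b → Term L s → Term L s
    ηIf true  a b a≢b e = η a b a≢b e
    ηIf false _ _ _   e = e

    label-ηIf : ∀ {s} β a b a≢b (e : Term L s) x → label (ηIf β a b a≢b e) x ≡ label e x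
    label-ηIf true  _ _ _ _ _ = refl
    label-ηIf false _ _ _ _ _ = refl

    adjacency-ηIf : ∀ {s} β a b a≢b (e : Term L s) x y →
                    adjacency (ηIf β a b a≢b e) x y
                    ≡ adjacency e x y ∨ (β ∧ joins a b (label e x) (label e y))
    adjacency-ηIf true  _ _ _ _ _ _ = refl
    adjacency-ηIf false _ _ _ e x y = sym (∨-identityʳ (adjacency e x y))

  shape : ∀ {k n} → CWExpr k n → Shape
  shape (cw-vert _)      = leaf
  shape (cw-union e f)   = node (shape e) (shape f)
  shape (cw-ρ _ _ _ e)   = shape e
  shape (cw-η _ _ _ e)   = shape e

  term : ∀ {k n} (e : CWExpr k n) → Term (Fin k) (shape e)
  term (cw-vert a)        = single a
  term (cw-union e f)     = union (term e) (term f)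
  term (cw-ρ a b a≢b e)   = ρ a b a≢b (term e)
  term (cw-η a b a≢b e)   = η a b a≢b (term e)

  vertices : ∀ {k n} (e : CWExpr k n) → Fin n ↔ Vertex (shape e)
  vertices (cw-vert _)    = 1↔⊤
  vertices (cw-union e f) = ↔-trans +↔⊎ (vertices e ⊎-↔ vertices f)
  vertices (cw-ρ _ _ _ e) = vertices e
  vertices (cw-η _ _ _ e) = vertices e

  label-term : ∀ {k n} (e : CWExpr k n) i → cw-lab e i ≡ label (term e) (to (vertices e) i)
  label-term (cw-vert _) i = refl
  label-term (cw-union {a} e f) i with splitAt a i
  ... | inj₁ x = label-term e x
  ... | inj₂ y = label-term f y
  label-term (cw-ρ a b _ e) i = cong (λ l → if l =ᴸ a then b else l) (label-term e i)
  label-term (cw-η _ _ _ e) i = label-term e i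

  adjacency-term : ∀ {k n} (e : CWExpr k n) i j →
                   cw-adj e i j ≡ adjacency (term e) (to (vertices e) i) (to (vertices e) j)
  adjacency-term (cw-vert _) i j = refl
  adjacency-term (cw-union {a} e f) i j with splitAt a i | splitAt a j
  ... | inj₁ x | inj₁ y = adjacency-term e x y
  ... | inj₂ x | inj₂ y = adjacency-term f x y
  ... | inj₁ _ | inj₂ _ = refl
  ... | inj₂ _ | inj₁ _ = refl
  adjacency-term (cw-ρ _ _ _ e) i j = adjacency-term e i j
  adjacency-term (cw-η a b _ e) i j =
    cong₂ _∨_ (adjacency-term e i j) (cong₂ (joins a b) (label-term e i) (label-term e j))

  term-≅ : ∀ {k n} (e : CWExpr k n) → cw-adj e ≅ adjacency (term e)
  term-≅ e = mk≅ (vertices e) (adjacency-term e)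

  expr : ∀ {k s} → Term (Fin k) s → CWExpr k (size s)
  expr (single a)      = cw-vert a
  expr (union e f)     = cw-union (expr e) (expr f)
  expr (ρ a b a≢b e)   = cw-ρ a b a≢b (expr e)
  expr (η a b a≢b e)   = cw-η a b a≢b (expr e)

  label-expr : ∀ {k s} (e : Term (Fin k) s) i → cw-lab (expr e) i ≡ label e (to (Fin↔Vertex s) i)
  label-expr (single a) i = refl
  label-expr (union {s} e f) i with splitAt (size s) i
  ... | inj₁ x = label-expr e x
  ... | inj₂ y = label-expr f y
  label-expr (ρ a b _ e) i = cong (λ l → if l =ᴸ a then b else l) (label-expr e i)
  label-expr (η _ _ _ e) i = label-expr e i

  adjacency-expr : ∀ {k s} (e : Term (Fin k) s) i j →
                   cw-adj (expr e) i j ≡ adjacency e (to (Fin↔Vertex s) i) (to (Fin↔Vertex s) j)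
  adjacency-expr (single a) i j = refl
  adjacency-expr (union {s} e f) i j with splitAt (size s) i | splitAt (size s) j
  ... | inj₁ x | inj₁ y = adjacency-expr e x y
  ... | inj₂ x | inj₂ y = adjacency-expr f x y
  ... | inj₁ _ | inj₂ _ = refl
  ... | inj₂ _ | inj₁ _ = refl
  adjacency-expr (ρ _ _ _ e) i j = adjacency-expr e i j
  adjacency-expr (η a b _ e) i j =
    cong₂ _∨_ (adjacency-expr e i j) (cong₂ (joins a b) (label-expr e i) (label-expr e j))

  expr-≅ : ∀ {k s} (e : Term (Fin k) s) → cw-adj (expr e) ≅ adjacency e
  expr-≅ {s = s} e = mk≅ (Fin↔Vertex s) (adjacency-expr e)

  realised : ∀ {k N M} {G : Graph M} (e : CWExpr k N) → cw-adj e ≅ adj G → HasCW G k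
  realised e e≅G with ≅⇒size≡ e≅G
  ... | refl = e , ≅⇒Iso e≅G

  module _ {A B : Set} {{_ : IsDecEquivalence {A = A} _≡_}} {{_ : IsDecEquivalence {A = B} _≡_}}
           (ι : Embedding A B) where
    open Embedding ι

    map : ∀ {s} → Term A s → Term B s
    map (single a)    = single (embed a)
    map (union e f)   = union (map e) (map f)
    map (ρ a b a≢b e) = ρ (embed a) (embed b) (a≢b ∘ embed-injective) (map e)
    map (η a b a≢b e) = η (embed a) (embed b) (a≢b ∘ embed-injective) (map e)

    =ᴸ-embed : ∀ x y → (embed x =ᴸ embed y) ≡ (x =ᴸ y)
    =ᴸ-embed x y with x ≟ y
    ... | yes refl = dec-true (embed x ≟ embed x) refl
    ... | no  x≢y  = dec-false (embed x ≟ embed y) (x≢y ∘ embed-injective)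

    joins-embed : ∀ a b x y → joins (embed a) (embed b) (embed x) (embed y) ≡ joins a b x y
    joins-embed a b x y rewrite =ᴸ-embed x a | =ᴸ-embed y b | =ᴸ-embed x b | =ᴸ-embed y a = refl

    label-map : ∀ {s} (e : Term A s) x → label (map e) x ≡ embed (label e x)
    label-map (single a)    x        = refl
    label-map (union e f)   (inj₁ x) = label-map e x
    label-map (union e f)   (inj₂ y) = label-map f y
    label-map (ρ a b _ e)   x rewrite label-map e x | =ᴸ-embed (label e x) a =
      sym (if-float embed (label e x =ᴸ a))
    label-map (η _ _ _ e)   x        = label-map e x

    adjacency-map : ∀ {s} (e : Term A s) x y → adjacency (map e) x y ≡ adjacency e x y
    adjacency-map (single a)  x        y        = refl
    adjacency-map (union e f) (inj₁ x) (inj₁ y) = adjacency-map e x y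
    adjacency-map (union e f) (inj₂ x) (inj₂ y) = adjacency-map f x y
    adjacency-map (union e f) (inj₁ _) (inj₂ _) = refl
    adjacency-map (union e f) (inj₂ _) (inj₁ _) = refl
    adjacency-map (ρ _ _ _ e) x        y        = adjacency-map e x y
    adjacency-map (η a b _ e) x        y        =
      cong₂ _∨_ (adjacency-map e x y)
                (trans (cong₂ (joins (embed a) (embed b)) (label-map e x) (label-map e y)) (joins-embed a b _ _))

  embeddedTerm-≅ : ∀ {k K n m} {G : Graph m} (k≤K : k ≤ K) (e : CWExpr k n) → cw-adj e ≅ adj G →
                   adjacency (map (inject≤-embedding k≤K) (term e)) ≅ adj G
  embeddedTerm-≅ k≤K e e≅G =
    ≅-trans (≡⇒≅ (adjacency-map _ (term e))) (≅-trans (≅-sym (term-≅ e)) e≅G)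

  module _ {A : Set} {{_ : IsDecEquivalence {A = A} _≡_}} where

    lift : ∀ {s} → Term A s → Term (A ⊎ Bool) s
    lift = map inj₁-embedding

    label-lift : ∀ {s} (e : Term A s) x → label (lift e) x ≡ inj₁ (label e x)
    label-lift = label-map inj₁-embedding

    adjacency-lift : ∀ {s} (e : Term A s) x y → adjacency (lift e) x y ≡ adjacency e x y
    adjacency-lift = adjacency-map inj₁-embedding

    port≢inj₁ : {a : A} → inj₂ true ≢ inj₁ a
    port≢inj₁ ()

    _[_≔_] : ∀ {s t} → Term A s → (u : Vertex s) → Term (A ⊎ Bool) t → Term (A ⊎ Bool) (plug s u t)
    single _    [ _      ≔ h ] = h
    union e f   [ inj₁ x ≔ h ] = union (e [ x ≔ h ]) (lift f)
    union e f   [ inj₂ y ≔ h ] = union (lift e) (f [ y ≔ h ])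
    ρ a b a≢b e [ u      ≔ h ] = ρ (inj₁ a) (inj₁ b) (a≢b ∘ inj₁-injective) (e [ u ≔ h ])
    η a b a≢b e [ u      ≔ h ] =  -- the port is joined wherever η a b joins u
      ηIf (label e u =ᴸ a) (inj₂ true) (inj₁ b) port≢inj₁
        (ηIf (label e u =ᴸ b) (inj₂ true) (inj₁ a) port≢inj₁
          (η (inj₁ a) (inj₁ b) (a≢b ∘ inj₁-injective) (e [ u ≔ h ])))

    ηEdges : A → A → A → Adj (A ⊎ Bool)
    ηEdges c a b x y = joins (inj₁ a) (inj₁ b) x y
                     ∨ c =ᴸ b ∧ joins (inj₂ true) (inj₁ a) x y
                     ∨ c =ᴸ a ∧ joins (inj₂ true) (inj₁ b) x y

    module _ {s t} (a b : A) (a≢b : a ≢ b) (e : Term A s) (u : Vertex s) (h : Term (A ⊎ Bool) t) where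

      private
        c = label e u
        e₀ = η (inj₁ a) (inj₁ b) (a≢b ∘ inj₁-injective) (e [ u ≔ h ])
        e₁ = ηIf (c =ᴸ b) (inj₂ true) (inj₁ a) port≢inj₁ e₀

      label-η≔ : ∀ x → label (η a b a≢b e [ u ≔ h ]) x ≡ label (e [ u ≔ h ]) x
      label-η≔ x = trans (label-ηIf (c =ᴸ a) _ _ _ e₁ x) (label-ηIf (c =ᴸ b) _ _ _ e₀ x)

      adjacency-η≔ : ∀ x y → adjacency (η a b a≢b e [ u ≔ h ]) x y
                             ≡ adjacency (e [ u ≔ h ]) x y
                               ∨ ηEdges c a b (label (e [ u ≔ h ]) x) (label (e [ u ≔ h ]) y)
      adjacency-η≔ x y = begin
        adjacency (ηIf (c =ᴸ a) (inj₂ true) (inj₁ b) port≢inj₁ e₁) x y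
          ≡⟨ adjacency-ηIf (c =ᴸ a) _ _ _ e₁ x y ⟩
        adjacency e₁ x y ∨ c =ᴸ a ∧ joins (inj₂ true) (inj₁ b) (label e₁ x) (label e₁ y)
          ≡⟨ cong₂ (λ p q → p ∨ c =ᴸ a ∧ q) (adjacency-ηIf (c =ᴸ b) _ _ _ e₀ x y)
                   (cong₂ (joins (inj₂ true) (inj₁ b))
                          (label-ηIf (c =ᴸ b) _ _ _ e₀ x) (label-ηIf (c =ᴸ b) _ _ _ e₀ y)) ⟩
        ((X ∨ J) ∨ C) ∨ D   ≡⟨ ∨-assoc (X ∨ J) C D ⟩
        (X ∨ J) ∨ (C ∨ D)   ≡⟨ ∨-assoc X J (C ∨ D) ⟩
        X ∨ J ∨ C ∨ D       ∎
        where
        open ≡-Reasoning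
        X = adjacency (e [ u ≔ h ]) x y
        J = joins (inj₁ a) (inj₁ b) (label (e [ u ≔ h ]) x) (label (e [ u ≔ h ]) y)
        C = c =ᴸ b ∧ joins (inj₂ true) (inj₁ a) (label (e [ u ≔ h ]) x) (label (e [ u ≔ h ]) y)
        D = c =ᴸ a ∧ joins (inj₂ true) (inj₁ b) (label (e [ u ≔ h ]) x) (label (e [ u ≔ h ]) y)

    private
      =ᴸtrue : ∀ β → (β =ᴸ true) ≡ β
      =ᴸtrue true  = refl
      =ᴸtrue false = refl

    open ∨-∧-Solver using (solve; _:=_; _:+_; _:*_; con)

    ηEdges-ports : ∀ c a b β β′ → ηEdges c a b (inj₂ β) (inj₂ β′) ≡ false
    ηEdges-ports c a b β β′ =
      solve 3 (λ β cₐ c_b → c_b :* (β :* con false :+ con false) :+ cₐ :* (β :* con false :+ con false)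
                            := con false)
            refl (β =ᴸ true) (c =ᴸ a) (c =ᴸ b)

    ηEdges-port-other : ∀ c a b β l → ηEdges c a b (inj₂ β) (inj₁ l) ≡ β ∧ joins a b c l
    ηEdges-port-other c a b β l = trans
      (solve 5 (λ β cₐ c_b lₐ l_b → c_b :* (β :* lₐ :+ con false) :+ cₐ :* (β :* l_b :+ con false)
                                    := β :* (cₐ :* l_b :+ c_b :* lₐ))
             refl (β =ᴸ true) (c =ᴸ a) (c =ᴸ b) (l =ᴸ a) (l =ᴸ b))
      (cong (_∧ joins a b c l) (=ᴸtrue β))

    ηEdges-other-port : ∀ c a b l β → ηEdges c a b (inj₁ l) (inj₂ β) ≡ β ∧ joins a b c l
    ηEdges-other-port c a b l β = trans
      (solve 5 (λ β cₐ c_b lₐ l_b → (lₐ :* con false :+ l_b :* con false)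
                                    :+ (c_b :* (con false :+ lₐ :* β) :+ cₐ :* (con false :+ l_b :* β))
                                    := β :* (cₐ :* l_b :+ c_b :* lₐ))
             refl (β =ᴸ true) (c =ᴸ a) (c =ᴸ b) (l =ᴸ a) (l =ᴸ b))
      (cong (_∧ joins a b c l) (=ᴸtrue β))

    ηEdges-others : ∀ c a b l l′ → ηEdges c a b (inj₁ l) (inj₁ l′) ≡ joins a b l l′
    ηEdges-others c a b l l′ =
      solve 5 (λ j cₐ c_b lₐ l_b → j :+ (c_b :* (con false :+ lₐ :* con false)
                                         :+ cₐ :* (con false :+ l_b :* con false))
                                   := j)
            refl (joins a b l l′) (c =ᴸ a) (c =ᴸ b) (l =ᴸ a) (l =ᴸ b)

  module _ {A : Set} {{_ : IsDecEquivalence {A = A} _≡_}} {t : Shape}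
           (h : Term (A ⊎ Bool) t) (port : Vertex t → Bool)
           (h-ports : ∀ z → label h z ≡ inj₂ (port z)) where

    label-≔-port : ∀ {s} (e : Term A s) u z → label (e [ u ≔ h ]) (plugIn s u (inj₁ z)) ≡ inj₂ (port z)
    label-≔-port (single _)    _        z = h-ports z
    label-≔-port (union e f)   (inj₁ x) z = label-≔-port e x z
    label-≔-port (union e f)   (inj₂ y) z = label-≔-port f y z
    label-≔-port (ρ a b _ e)   u        z =
      cong (λ ℓ → if ℓ =ᴸ inj₁ a then inj₁ b else ℓ) (label-≔-port e u z)
    label-≔-port (η a b a≢b e) u        z = trans (label-η≔ a b a≢b e u h _) (label-≔-port e u z)

    label-≔-other : ∀ {s} (e : Term A s) u r →
                    label (e [ u ≔ h ]) (plugIn s u (inj₂ r)) ≡ inj₁ (label e (vertex r))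
    label-≔-other (single _)    _        (_ , tt≢tt)  = ⊥-elim-irr (tt≢tt refl)
    label-≔-other (union e f)   (inj₁ x) (inj₁ y , _) = label-≔-other e x (y , _)
    label-≔-other (union e f)   (inj₁ x) (inj₂ y , _) = label-lift f y
    label-≔-other (union e f)   (inj₂ x) (inj₁ y , _) = label-lift e y
    label-≔-other (union e f)   (inj₂ x) (inj₂ y , _) = label-≔-other f x (y , _)
    label-≔-other (ρ a b _ e)   u        r            =
      trans (cong (λ ℓ → if ℓ =ᴸ inj₁ a then inj₁ b else ℓ) (label-≔-other e u r))
            (sym (if-float inj₁ (label e (vertex r) =ᴸ a)))
    label-≔-other (η a b a≢b e) u        r            =
      trans (label-η≔ a b a≢b e u h _) (label-≔-other e u r)

    SubstitutionCorrect : ∀ {s} → Term A s → Vertex s → Set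
    SubstitutionCorrect {s} e u = ∀ c c′ → adjacency (e [ u ≔ h ]) (plugIn s u c) (plugIn s u c′)
                                           ≡ substitute (adjacency e) u (adjacency h) port c c′

    union-≔ˡ : ∀ {s r} (e : Term A s) (f : Term A r) x →
               SubstitutionCorrect e x → SubstitutionCorrect (union e f) (inj₁ x)
    union-≔ˡ e f x IH (inj₁ z) (inj₁ z′) = IH (inj₁ z) (inj₁ z′)
    union-≔ˡ e f x IH (inj₁ z) (inj₂ (inj₁ y , _)) = IH (inj₁ z) (inj₂ (y , _))
    union-≔ˡ e f x IH (inj₁ z) (inj₂ (inj₂ q , _)) = sym (∧-zeroʳ (port z))
    union-≔ˡ e f x IH (inj₂ (inj₁ y , _)) (inj₁ z) = IH (inj₂ (y , _)) (inj₁ z)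
    union-≔ˡ e f x IH (inj₂ (inj₂ q , _)) (inj₁ z) = sym (∧-zeroʳ (port z))
    union-≔ˡ e f x IH (inj₂ (inj₁ y , _)) (inj₂ (inj₁ y′ , _)) = IH (inj₂ (y , _)) (inj₂ (y′ , _))
    union-≔ˡ e f x IH (inj₂ (inj₁ y , _)) (inj₂ (inj₂ q , _))  = refl
    union-≔ˡ e f x IH (inj₂ (inj₂ q , _)) (inj₂ (inj₁ y , _))  = refl
    union-≔ˡ e f x IH (inj₂ (inj₂ q , _)) (inj₂ (inj₂ q′ , _)) = adjacency-lift f q q′

    union-≔ʳ : ∀ {r s} (e : Term A r) (f : Term A s) y →
               SubstitutionCorrect f y → SubstitutionCorrect (union e f) (inj₂ y)
    union-≔ʳ e f y IH (inj₁ z) (inj₁ z′) = IH (inj₁ z) (inj₁ z′)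
    union-≔ʳ e f y IH (inj₁ z) (inj₂ (inj₂ q , _)) = IH (inj₁ z) (inj₂ (q , _))
    union-≔ʳ e f y IH (inj₁ z) (inj₂ (inj₁ p , _)) = sym (∧-zeroʳ (port z))
    union-≔ʳ e f y IH (inj₂ (inj₂ q , _)) (inj₁ z) = IH (inj₂ (q , _)) (inj₁ z)
    union-≔ʳ e f y IH (inj₂ (inj₁ p , _)) (inj₁ z) = sym (∧-zeroʳ (port z))
    union-≔ʳ e f y IH (inj₂ (inj₂ q , _)) (inj₂ (inj₂ q′ , _)) = IH (inj₂ (q , _)) (inj₂ (q′ , _))
    union-≔ʳ e f y IH (inj₂ (inj₂ q , _)) (inj₂ (inj₁ p , _))  = refl
    union-≔ʳ e f y IH (inj₂ (inj₁ p , _)) (inj₂ (inj₂ q , _))  = refl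
    union-≔ʳ e f y IH (inj₂ (inj₁ p , _)) (inj₂ (inj₁ p′ , _)) = adjacency-lift e p p′

    private
      η-step : ∀ {s} a b a≢b (e : Term A s) u → SubstitutionCorrect e u → ∀ c c′ {ℓ ℓ′} →
               label (e [ u ≔ h ]) (plugIn s u c) ≡ ℓ → label (e [ u ≔ h ]) (plugIn s u c′) ≡ ℓ′ →
               adjacency (η a b a≢b e [ u ≔ h ]) (plugIn s u c) (plugIn s u c′)
               ≡ substitute (adjacency e) u (adjacency h) port c c′ ∨ ηEdges (label e u) a b ℓ ℓ′
      η-step a b a≢b e u IH c c′ ℓ≡ ℓ′≡ =
        trans (adjacency-η≔ a b a≢b e u h _ _)
              (cong₂ _∨_ (IH c c′) (cong₂ (ηEdges _ a b) ℓ≡ ℓ′≡))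

    η-≔ : ∀ {s} a b a≢b (e : Term A s) u → SubstitutionCorrect e u → SubstitutionCorrect (η a b a≢b e) u
    η-≔ a b a≢b e u IH (inj₁ z) (inj₁ z′) =
      trans (η-step a b a≢b e u IH (inj₁ z) (inj₁ z′) (label-≔-port e u z) (label-≔-port e u z′))
            (trans (cong (adjacency h z z′ ∨_) (ηEdges-ports _ a b (port z) (port z′))) (∨-identityʳ _))
    η-≔ a b a≢b e u IH (inj₁ z) (inj₂ r) =
      trans (η-step a b a≢b e u IH (inj₁ z) (inj₂ r) (label-≔-port e u z) (label-≔-other e u r))
            (trans (cong (port z ∧ adjacency e u (vertex r) ∨_) (ηEdges-port-other _ a b _ _))
                   (sym (∧-distribˡ-∨ (port z) _ _)))
    η-≔ a b a≢b e u IH (inj₂ r) (inj₁ z) =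
      trans (η-step a b a≢b e u IH (inj₂ r) (inj₁ z) (label-≔-other e u r) (label-≔-port e u z))
            (trans (cong (port z ∧ adjacency e u (vertex r) ∨_) (ηEdges-other-port _ a b _ _))
                   (sym (∧-distribˡ-∨ (port z) _ _)))
    η-≔ a b a≢b e u IH (inj₂ r) (inj₂ r′) =
      trans (η-step a b a≢b e u IH (inj₂ r) (inj₂ r′) (label-≔-other e u r) (label-≔-other e u r′))
            (cong (adjacency e (vertex r) (vertex r′) ∨_) (ηEdges-others _ a b _ _))

    adjacency-≔ : ∀ {s} (e : Term A s) u → SubstitutionCorrect e u
    adjacency-≔ (single _)    _        (inj₁ z)           (inj₁ z′)          = refl
    adjacency-≔ (single _)    _        (inj₁ z)           (inj₂ (_ , tt≢tt)) = ⊥-elim-irr (tt≢tt refl)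
    adjacency-≔ (single _)    _        (inj₂ (_ , tt≢tt)) _                  = ⊥-elim-irr (tt≢tt refl)
    adjacency-≔ (union e f)   (inj₁ x) = union-≔ˡ e f x (adjacency-≔ e x)
    adjacency-≔ (union e f)   (inj₂ y) = union-≔ʳ e f y (adjacency-≔ f y)
    adjacency-≔ (ρ _ _ _ e)   u        = adjacency-≔ e u
    adjacency-≔ (η a b a≢b e) u        = η-≔ a b a≢b e u (adjacency-≔ e u)

  module _ {A : Set} {{_ : IsDecEquivalence {A = A} _≡_}} where

    forgetAll : ∀ {s} → List A → Term (A ⊎ Bool) s → Term (A ⊎ Bool) s
    forgetAll []       e = e
    forgetAll (a ∷ as) e = forgetAll as (ρ (inj₁ a) (inj₂ false) (λ ()) e)

    adjacency-forgetAll : ∀ {s} as (e : Term (A ⊎ Bool) s) x y →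
                          adjacency (forgetAll as e) x y ≡ adjacency e x y
    adjacency-forgetAll []       e x y = refl
    adjacency-forgetAll (a ∷ as) e x y = adjacency-forgetAll as _ x y

    label-forgetAll-port : ∀ {s} as (e : Term (A ⊎ Bool) s) x {β} →
                           label e x ≡ inj₂ β → label (forgetAll as e) x ≡ inj₂ β
    label-forgetAll-port []       e x ℓ≡ = ℓ≡
    label-forgetAll-port (a ∷ as) e x ℓ≡ =
      label-forgetAll-port as _ x (cong (λ ℓ → if ℓ =ᴸ inj₁ a then inj₂ false else ℓ) ℓ≡)

    label-forgetAll-other : ∀ {s} as (e : Term (A ⊎ Bool) s) x {l} →
                            label e x ≡ inj₁ l → l ∈ as → label (forgetAll as e) x ≡ inj₂ false
    label-forgetAll-other (a ∷ as) e x {l} ℓ≡ l∈a∷as with l ≟ a | step ℓ≡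
      where
      step : ∀ {ℓ} → ℓ ≡ inj₁ l →
             (if ℓ =ᴸ inj₁ a then inj₂ false else ℓ) ≡ (if l =ᴸ a then inj₂ false else inj₁ l)
      step refl = refl
    ... | yes _   | ℓ′≡ = label-forgetAll-port as _ x ℓ′≡
    ... | no  l≢a | ℓ′≡ = label-forgetAll-other as _ x ℓ′≡ (tail l≢a l∈a∷as)

  mark : ∀ {k s} → Term (Fin k) s → (u : Vertex s) → Term (Fin k ⊎ Bool) (plug s u leaf)
  mark {k} e u = forgetAll (allFin k) (e [ u ≔ single (inj₂ true) ])

  module _ {k : ℕ} {s : Shape} (e : Term (Fin k) s) (u : Vertex s) where

    label-mark : ∀ z → label (mark e u) z ≡ inj₂ (is-just (isInj₁ (plugOut s u z)))
    label-mark z with plugOut s u z | plugIn-plugOut s u z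
    ... | inj₁ tt | refl =
      label-forgetAll-port (allFin k) _ _ (label-≔-port (single (inj₂ true)) _ (λ _ → refl) e u tt)
    ... | inj₂ r  | refl =
      label-forgetAll-other (allFin k) _ _ (label-≔-other (single (inj₂ true)) _ (λ _ → refl) e u r)
                            (∈-allFin _)

    adjacency-mark : ∀ c c′ → adjacency (mark e u) (plugIn s u c) (plugIn s u c′)
                              ≡ substitute (adjacency e) u (λ _ _ → false) (λ _ → true) c c′
    adjacency-mark c c′ = trans (adjacency-forgetAll (allFin k) _ _ _)
                                (adjacency-≔ (single (inj₂ true)) (λ _ → true) (λ _ → refl) e u c c′)

  oneSum-bound : ∀ {n₁ m₂ k₁ k₂} (G₁ : Graph n₁) (G₂ : Graph (suc m₂))
                 (v : Fin n₁) (w : Fin (suc m₂)) →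
                 HasCW G₁ k₁ → HasCW G₂ k₂ → HasCW (oneSum G₁ G₂ v w) (k₁ ⊔ k₂ + 2)
  oneSum-bound {k₁ = k₁} {k₂} G₁ G₂ v w (e₁ , e₁≅G₁) (e₂ , e₂≅G₂) =
    realised {G = oneSum G₁ G₂ v w} (expr (map encoding glue))
      (≅-trans (expr-≅ (map encoding glue)) (≅-trans (≡⇒≅ (adjacency-map encoding glue)) glue≅oneSum))
    where
    t₁ = map (inject≤-embedding (m≤m⊔n k₁ k₂)) (term e₁)
    t₂ = map (inject≤-embedding (m≤n⊔m k₁ k₂)) (term e₂)
    open OneSum G₁ G₂ v w (embeddedTerm-≅ {G = G₁} (m≤m⊔n k₁ k₂) e₁ (Iso⇒≅ e₁≅G₁))
                          (embeddedTerm-≅ {G = G₂} (m≤n⊔m k₁ k₂) e₂ (Iso⇒≅ e₂≅G₂))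

    glue : Term (Fin (k₁ ⊔ k₂) ⊎ Bool) (plug (shape e₂) ŵ markedShape)
    glue = t₂ [ ŵ ≔ mark t₁ v̂ ]

    glue≅oneSum : adjacency glue ≅ adj (oneSum G₁ G₂ v w)
    glue≅oneSum = realises-oneSum (adjacency-mark t₁ v̂)
                                  (adjacency-≔ (mark t₁ v̂) isPort (label-mark t₁ v̂) t₂ ŵ)

    encoding : Embedding (Fin (k₁ ⊔ k₂) ⊎ Bool) (Fin (k₁ ⊔ k₂ + 2))
    encoding = ↔⇒embedding (↔-trans (↔-refl ⊎-↔ ↔-sym 2↔Bool) (↔-sym (+↔⊎ {k₁ ⊔ k₂})))

theorem4 : ∀ {n₁ m₂ : ℕ} (G₁ : Graph n₁) (G₂ : Graph (suc m₂))
               (v : Fin n₁) (w : Fin (suc m₂)) →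
               (∀ k₁ k₂ k → IsNLCW G₁ k₁ → IsNLCW G₂ k₂ →
                  IsNLCW (oneSum G₁ G₂ v w) k → k ≤ (k₁ ⊔ k₂) + 2)
               × (∀ k₁ k₂ k → IsCW G₁ k₁ → IsCW G₂ k₂ →
                  IsCW (oneSum G₁ G₂ v w) k → k ≤ (k₁ ⊔ k₂) + 2)
theorem4 G₁ G₂ v w =
  (λ k₁ k₂ k (e₁ , _) (e₂ , _) (_ , minimal) → minimal _ (NLC.oneSum-bound G₁ G₂ v w e₁ e₂)) ,
  (λ k₁ k₂ k (e₁ , _) (e₂ , _) (_ , minimal) → minimal _ (CW.oneSum-bound G₁ G₂ v w e₁ e₂))
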